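{- Every universal instance contains at least $12$ cubes.
   Context: Fix a palette of six distinct colors. A (colored) cube is a unit cube each of whose six faces is painted with exactly one color of the palette, all six faces receiving different colors. Two colored cubes have the same variety if one can be rotated onto the other; there are exactly 30 varieties. An instance is a finite multiset of colored cubes (several cubes of the same variety are allowed); its size is the number of cubes counted with multiplicity. A solid is a $2\times2\times2$ cube assembled from eight colored unit cubes such that each of its six outer $2\times2$ faces is of a single color and the six outer faces have six different colors; its variety is defined as for unit cubes. A solid of variety $v$ is composable from an instance $I$ if some eight cubes of $I$ can be placed and oriented to form a solid of variety $v$. An instance is universal if a solid of every one of the 30 varieties is composable from it. -}

module Defs where

open import Data.Bool using (Bool; true; false)
open import Data.Fin using (Fin)
open import Data.List using (List; []; _∷_; length; lookup)
open import Data.Product using (Σ; ∃; _×_; _,_)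
open import Function.Definitions using (Injective)
open import Relation.Binary.PropositionalEquality using (_≡_)

Color : Set
Color = Fin 6

data Face : Set where
  +x -x +y -y +z -z : Face

data Axis : Set where
  X Y Z : Axis

axis : Face → Axis
axis +x = X
axis -x = X
axis +y = Y
axis -y = Y
axis +z = Z
axis -z = Z

side : Face → Bool
side +x = true
side -x = false
side +y = true
side -y = false
side +z = true
side -z = false

data Gen : Set where
  qx qy qz : Gen

turn : Gen → Face → Face
turn qx +y = +z
turn qx +z = -y
turn qx -y = -z
turn qx -z = +y
turn qx f  = f
turn qy +z = +x
turn qy +x = -z
turn qy -z = -x
turn qy -x = +z
turn qy f  = f
turn qz +x = +y
turn qz +y = -x
turn qz -x = -y
turn qz -y = +x
turn qz f  = f

-- A rotation of the cube is a finite product of quarter turns about the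
-- coordinate axes (these generate the 24-element rotation group).
Rotation : Set
Rotation = List Gen

act : Rotation → Face → Face
act []      f = f
act (g ∷ r) f = turn g (act r f)

Coloring : Set
Coloring = Face → Color

record Cube : Set where
  constructor cube
  field
    col : Coloring
    distinct : Injective _≡_ _≡_ col
open Cube public

SameVariety : Coloring → Coloring → Set
SameVariety c d = ∃ λ (ρ : Rotation) → ∀ f → c (act ρ f) ≡ d f

-- An instance: a finite multiset of cubes, represented as a list.
Instance : Set
Instance = List Cube

size : Instance → _
size = length

-- Positions of the eight unit cubes in the 2×2×2 solid
-- (one Bool per axis, true = positive half).
Pos : Set
Pos = Bool × Bool × Bool

coord : Pos → Axis → Bool
coord (a , b , c) X = a
coord (a , b , c) Y = b
coord (a , b , c) Z = c

-- Face f of the unit cube at position p lies on the outer face of the solid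
-- whose outward normal is f.
Outer : Pos → Face → Set
Outer p f = coord p (axis f) ≡ side f

-- A solid with outer colouring s is composable from instance I:
-- eight distinct members of I (an injective selection of list indices)
-- are placed at the eight positions with chosen orientations so that every
-- outer face of the 2×2×2 cube is monochromatic, the outer face with normal f
-- having colour s f, and the six outer colours are pairwise different.
ComposableWith : Instance → Coloring → Set
ComposableWith I s =
  Σ (Pos → Fin (length I)) λ sel →
    Injective _≡_ _≡_ sel ×
    Σ (Pos → Rotation) λ rot →
      (∀ p f → Outer p f → col (lookup I (sel p)) (act (rot p) f) ≡ s f) ×
      Injective _≡_ _≡_ s

Composable : Instance → Cube → Set
Composable I v = Σ Coloring λ s → ComposableWith I s × SameVariety s (col v)

Universal : Instance → Set
Universal I = ∀ (v : Cube) → Composable I v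

-- Double counting of the pairs (cube of the instance, variety v) such that the cube fits v:
-- in some orientation it agrees with v on at least one face of each pair of opposite faces.
-- Every unit cube of a solid of variety v shows one face of each opposite pair on the
-- outside, so a universal instance has at least 8 cubes fitting each of the 30 varieties,
-- at least 240 pairs.  On the other hand an exhaustive search over the 720 colored cubes
-- and the 24 rotations shows that every cube fits only 21 varieties, so the instance has
-- at least 240 / 21 > 11 cubes.
module Submission where

open import Defs
open import Data.Bool using (Bool; true; false)
open import Data.Bool.Properties using () renaming (_≟_ to _≟ᵇ_)
open import Data.Fin using (Fin; zero; suc; toℕ; punchIn; punchOut)
open import Data.Fin.Patterns using (0F; 1F; 2F; 3F; 4F; 5F; 6F; 7F)
open import Data.Fin.Properties
  using (all?; any?; ¬Fin0; 0≢1+n; suc-injective; punchInᵢ≢i; punchIn-injective;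
         punchOut-injective; punchIn-punchOut)
  renaming (_≟_ to _≟ᶜ_)
open import Data.Fin.Subset using (Subset; ∣_∣; _∈_; _-_)
open import Data.Fin.Subset.Properties using (x∈p∧x≢y⇒x∈p-y; x∈p⇒∣p-x∣<∣p∣)
open import Data.List using ([]; _∷_; _++_; replicate; length; lookup)
open import Data.Nat using (ℕ; zero; suc; _+_; _*_; _≤_; _≤?_; _<?_; z≤n; s≤s)
open import Data.Nat.Properties using (+-0-commutativeMonoid; +-mono-≤; ≤-trans; <-≤-trans; *-cancelʳ-<; module ≤-Reasoning)
open import Data.Product using (∃; ∃₂; _×_; _,_)
open import Data.Product.Properties using (≡-dec)
open import Data.Sum using (_⊎_; inj₁; inj₂; swap) renaming (map to map-⊎)
open import Data.Vec as Vec using (tabulate) renaming (lookup to lookupᵛ)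
open import Data.Vec.Properties using (tabulate-cong; lookup∘tabulate; lookup⇒[]=)
open import Function using (_∘_)
open import Function.Bundles using (mk⇔)
open import Function.Definitions using (Injective)
open import Relation.Binary.PropositionalEquality
open import Relation.Nullary using (Dec; does; yes; contradiction)
open import Relation.Nullary.Decidable
  using (map′; from-yes; does-⇔; dec-true; _×-dec_; _⊎-dec_; _→-dec_)
open import Algebra.Properties.CommutativeMonoid.Sum +-0-commutativeMonoid
  using (sum-syntax; ∑-comm; sum-cong-≗)

opp : Face → Face
opp +x = -x
opp -x = +x
opp +y = -y
opp -y = +y
opp +z = -z
opp -z = +z

turn-opp : ∀ g f → turn g (opp f) ≡ opp (turn g f)
turn-opp qx +x = refl
turn-opp qx -x = refl
turn-opp qx +y = refl
turn-opp qx -y = refl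
turn-opp qx +z = refl
turn-opp qx -z = refl
turn-opp qy +x = refl
turn-opp qy -x = refl
turn-opp qy +y = refl
turn-opp qy -y = refl
turn-opp qy +z = refl
turn-opp qy -z = refl
turn-opp qz +x = refl
turn-opp qz -x = refl
turn-opp qz +y = refl
turn-opp qz -y = refl
turn-opp qz +z = refl
turn-opp qz -z = refl

act-opp : ∀ ρ f → act ρ (opp f) ≡ opp (act ρ f)
act-opp []      f = refl
act-opp (g ∷ ρ) f = trans (cong (turn g) (act-opp ρ f)) (turn-opp g (act ρ f))

act-++ : ∀ σ ρ f → act (σ ++ ρ) f ≡ act σ (act ρ f)
act-++ []      ρ f = refl
act-++ (g ∷ σ) ρ f = cong (turn g) (act-++ σ ρ f)

face : Fin 6 → Face
face 0F = +x
face 1F = -x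
face 2F = +y
face 3F = -y
face 4F = +z
face 5F = -z

index : Face → Fin 6
index +x = 0F
index -x = 1F
index +y = 2F
index -y = 3F
index +z = 4F
index -z = 5F

face∘index : ∀ f → face (index f) ≡ f
face∘index +x = refl
face∘index -x = refl
face∘index +y = refl
face∘index -y = refl
face∘index +z = refl
face∘index -z = refl

index∘face : ∀ i → index (face i) ≡ i
index∘face 0F = refl
index∘face 1F = refl
index∘face 2F = refl
index∘face 3F = refl
index∘face 4F = refl
index∘face 5F = refl

face-injective : Injective _≡_ _≡_ face
face-injective e = trans (sym (index∘face _)) (trans (cong index e) (index∘face _))

_≟_ : (f g : Face) → Dec (f ≡ g)
f ≟ g = map′ index-injective (cong index) (index f ≟ᶜ index g)
  where
  index-injective : index f ≡ index g → f ≡ g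
  index-injective e = trans (sym (face∘index f)) (trans (cong face e) (face∘index g))

∀-face? : {P : Face → Set} → (∀ f → Dec (P f)) → Dec (∀ f → P f)
∀-face? {P} P? = map′ (λ h f → subst P (face∘index f) (h (index f))) (λ h → h ∘ face) (all? (P? ∘ face))

_≗?_ : (σ τ : Face → Face) → Dec (σ ≗ τ)
σ ≗? τ = ∀-face? λ f → σ f ≟ τ f

-- tilt i brings face i to +z; composing with the four spins about z gives all 24 rotations
tilt : Fin 6 → Rotation
tilt 0F = qy ∷ qy ∷ qy ∷ []
tilt 1F = qy ∷ []
tilt 2F = qx ∷ []
tilt 3F = qx ∷ qx ∷ qx ∷ []
tilt 4F = []
tilt 5F = qx ∷ qx ∷ []

rotation : Fin 6 → Fin 4 → Rotation
rotation i j = replicate (toℕ j) qz ++ tilt i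

IsRotation : (Face → Face) → Set
IsRotation σ = ∃₂ λ i j → σ ≗ act (rotation i j)

isRotation? : ∀ σ → Dec (IsRotation σ)
isRotation? σ = any? λ i → any? λ j → σ ≗? act (rotation i j)

rotation-closed : ∀ g i j → IsRotation (turn g ∘ act (rotation i j))
rotation-closed qx = from-yes (all? λ i → all? λ j → isRotation? (turn qx ∘ act (rotation i j)))
rotation-closed qy = from-yes (all? λ i → all? λ j → isRotation? (turn qy ∘ act (rotation i j)))
rotation-closed qz = from-yes (all? λ i → all? λ j → isRotation? (turn qz ∘ act (rotation i j)))

act-isRotation : ∀ ρ → IsRotation (act ρ)
act-isRotation []      = 4F , 0F , λ _ → refl
act-isRotation (g ∷ ρ) =
  let (i , j , ρ≗ij) = act-isRotation ρ
      (i′ , j′ , gij≗i′j′) = rotation-closed g i j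
  in i′ , j′ , λ f → trans (cong (turn g) (ρ≗ij f)) (gij≗i′j′ f)

positive : Axis → Face
positive X = +x
positive Y = +y
positive Z = +z

∀-axis? : {P : Axis → Set} → (∀ a → Dec (P a)) → Dec (∀ a → P a)
∀-axis? P? = map′ (λ { (x , y , z) X → x ; (x , y , z) Y → y ; (x , y , z) Z → z })
                  (λ h → h X , h Y , h Z)
                  (P? X ×-dec P? Y ×-dec P? Z)

FitsVia : Coloring → Coloring → (Face → Face) → Set
FitsVia c v σ = ∀ a → let f = positive a in c (σ f) ≡ v f ⊎ c (σ (opp f)) ≡ v (opp f)

Fits : Coloring → Coloring → Set
Fits c v = ∃ λ ρ → FitsVia c v (act ρ)

fitsVia? : ∀ c v σ → Dec (FitsVia c v σ)
fitsVia? c v σ = ∀-axis? λ a → let f = positive a in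
  (c (σ f) ≟ᶜ v f) ⊎-dec (c (σ (opp f)) ≟ᶜ v (opp f))

fitsVia-resp-≗ : ∀ {c v σ τ} → σ ≗ τ → FitsVia c v σ → FitsVia c v τ
fitsVia-resp-≗ {c} σ≗τ h a = let f = positive a in
  map-⊎ (trans (cong c (sym (σ≗τ f)))) (trans (cong c (sym (σ≗τ (opp f))))) (h a)

fits? : ∀ c v → Dec (Fits c v)
fits? c v = map′ (λ (i , j , h) → rotation i j , h)
                 (λ (ρ , h) → let (i , j , ρ≗ij) = act-isRotation ρ in i , j , fitsVia-resp-≗ {c} {v} ρ≗ij h)
                 (any? λ i → any? λ j → fitsVia? c v (act (rotation i j)))

fits-resp-≗ : ∀ {c d v} → c ≗ d → Fits c v → Fits d v
fits-resp-≗ c≗d (ρ , h) = ρ , λ a → let f = positive a in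
  map-⊎ (trans (sym (c≗d (act ρ f)))) (trans (sym (c≗d (act ρ (opp f))))) (h a)

true-or-false : ∀ b → b ≡ true ⊎ b ≡ false
true-or-false true  = inj₁ refl
true-or-false false = inj₂ refl

outer-or : ∀ p f → Outer p f ⊎ Outer p (opp f)
outer-or (x , y , z) +x = true-or-false x
outer-or (x , y , z) -x = swap (true-or-false x)
outer-or (x , y , z) +y = true-or-false y
outer-or (x , y , z) -y = swap (true-or-false y)
outer-or (x , y , z) +z = true-or-false z
outer-or (x , y , z) -z = swap (true-or-false z)

placed-fits : ∀ {c s v : Coloring} {p} τ ρ →
  (∀ f → Outer p f → c (act τ f) ≡ s f) → (∀ f → s (act ρ f) ≡ v f) → Fits c v
placed-fits {c} {s} {v} {p} τ ρ placed s≈v = τ ++ ρ , fits-on-axis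
  where
  agrees : ∀ f → Outer p (act ρ f) → c (act (τ ++ ρ) f) ≡ v f
  agrees f outer = begin
    c (act (τ ++ ρ) f)  ≡⟨ cong c (act-++ τ ρ f) ⟩
    c (act τ (act ρ f)) ≡⟨ placed (act ρ f) outer ⟩
    s (act ρ f)         ≡⟨ s≈v f ⟩
    v f                 ∎
    where open ≡-Reasoning
  fits-on-axis : FitsVia c v (act (τ ++ ρ))
  fits-on-axis a with outer-or p (act ρ (positive a))
  ... | inj₁ outer = inj₁ (agrees _ outer)
  ... | inj₂ outer = inj₂ (agrees _ (subst (Outer p) (sym (act-opp ρ (positive a))) outer))

_◂_ : ∀ {m n} → Fin (suc n) → (Fin m → Fin n) → Fin (suc m) → Fin (suc n)
(a ◂ g) zero    = a
(a ◂ g) (suc k) = punchIn a (g k)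

◂-injective : ∀ {m n} (a : Fin (suc n)) {g : Fin m → Fin n} →
  Injective _≡_ _≡_ g → Injective _≡_ _≡_ (a ◂ g)
◂-injective a g-inj {zero}  {zero}  _ = refl
◂-injective a g-inj {zero}  {suc l} e = contradiction (sym e) (punchInᵢ≢i a _)
◂-injective a g-inj {suc k} {zero}  e = contradiction e (punchInᵢ≢i a _)
◂-injective a g-inj {suc k} {suc l} e = cong suc (g-inj (punchIn-injective a _ _ e))

◂-cong : ∀ {m n} (a : Fin (suc n)) {g h : Fin m → Fin n} → g ≗ h → (a ◂ g) ≗ (a ◂ h)
◂-cong a g≗h zero    = refl
◂-cong a g≗h (suc k) = cong (punchIn a) (g≗h k)

injection-◂ : ∀ {m n} (f : Fin (suc m) → Fin (suc n)) → Injective _≡_ _≡_ f →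
  ∃ λ (g : Fin m → Fin n) → Injective _≡_ _≡_ g × f ≗ (f zero ◂ g)
injection-◂ {m} {n} f f-inj = g , g-inj , f≗
  where
  avoids : ∀ k → f zero ≢ f (suc k)
  avoids k = 0≢1+n ∘ f-inj
  g : Fin m → Fin n
  g k = punchOut (avoids k)
  g-inj : Injective _≡_ _≡_ g
  g-inj e = suc-injective (f-inj (punchOut-injective (avoids _) (avoids _) e))
  f≗ : f ≗ (f zero ◂ g)
  f≗ zero    = refl
  f≗ (suc k) = sym (punchIn-punchOut (avoids k))

all-injections? : ∀ {m n} (P : (Fin m → Fin n) → Set) → (∀ {f g} → f ≗ g → P f → P g) →
  (∀ f → Dec (P f)) → Dec (∀ f → Injective _≡_ _≡_ f → P f)
all-injections? {zero} {n}      P resp P? = map′ (λ p f _ → resp (λ ()) p) (λ h → h empty λ { {()} }) (P? empty)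
  where
  empty : Fin 0 → Fin n
  empty ()
all-injections? {suc m} {zero}  P resp P? = yes λ f _ → contradiction (f zero) ¬Fin0
all-injections? {suc m} {suc n} P resp P? =
  map′ sound complete (all? λ a → all-injections? (P ∘ (a ◂_)) (resp ∘ ◂-cong a) (P? ∘ (a ◂_)))
  where
  sound : (∀ a g → Injective _≡_ _≡_ g → P (a ◂ g)) → ∀ f → Injective _≡_ _≡_ f → P f
  sound h f f-inj = let (g , g-inj , f≗) = injection-◂ f f-inj in resp (sym ∘ f≗) (h (f zero) g g-inj)
  complete : (∀ f → Injective _≡_ _≡_ f → P f) → ∀ a g → Injective _≡_ _≡_ g → P (a ◂ g)
  complete h a g g-inj = h (a ◂ g) (◂-injective a g-inj)

indicator : Bool → ℕ
indicator true  = 1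
indicator false = 0

∣tabulate∣≡∑ : ∀ {n} (b : Fin n → Bool) → ∣ tabulate b ∣ ≡ ∑[ i < n ] indicator (b i)
∣tabulate∣≡∑ {zero}  b = refl
∣tabulate∣≡∑ {suc n} b with b zero
... | true  = cong suc (∣tabulate∣≡∑ (b ∘ suc))
... | false = ∣tabulate∣≡∑ (b ∘ suc)

∈-tabulate : ∀ {n} {b : Fin n → Bool} {i} → b i ≡ true → i ∈ tabulate b
∈-tabulate {b = b} {i} bi≡true = lookup⇒[]= i (tabulate b) (trans (lookup∘tabulate b i) bi≡true)

injection⇒≤∣p∣ : ∀ {m n} {p : Subset n} (f : Fin m → Fin n) → Injective _≡_ _≡_ f → (∀ k → f k ∈ p) → m ≤ ∣ p ∣
injection⇒≤∣p∣ {zero}  f f-inj f∈p = z≤n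
injection⇒≤∣p∣ {suc m} {p = p} f f-inj f∈p = ≤-trans (s≤s m≤∣p-f0∣) (x∈p⇒∣p-x∣<∣p∣ (f∈p zero))
  where
  m≤∣p-f0∣ : m ≤ ∣ p - f zero ∣
  m≤∣p-f0∣ = injection⇒≤∣p∣ (f ∘ suc) (suc-injective ∘ f-inj)
    (λ k → x∈p∧x≢y⇒x∈p-y (f∈p (suc k)) (0≢1+n ∘ sym ∘ f-inj))

double-counting : ∀ {m n} (b : Fin m → Fin n → Bool) →
  ∑[ i < m ] ∣ tabulate (b i) ∣ ≡ ∑[ j < n ] ∣ tabulate (λ i → b i j) ∣
double-counting {m} {n} b = begin
  ∑[ i < m ] ∣ tabulate (b i) ∣              ≡⟨ sum-cong-≗ (∣tabulate∣≡∑ ∘ b) ⟩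
  ∑[ i < m ] ∑[ j < n ] indicator (b i j)    ≡⟨ ∑-comm (λ i j → indicator (b i j)) ⟩
  ∑[ j < n ] ∑[ i < m ] indicator (b i j)    ≡⟨ sum-cong-≗ (λ j → ∣tabulate∣≡∑ (λ i → b i j)) ⟨
  ∑[ j < n ] ∣ tabulate (λ i → b i j) ∣      ∎
  where open ≡-Reasoning

∑-mono-≤ : ∀ {n} {f g : Fin n → ℕ} → (∀ i → f i ≤ g i) → ∑[ i < n ] f i ≤ ∑[ i < n ] g i
∑-mono-≤ {zero}  f≤g = z≤n
∑-mono-≤ {suc n} f≤g = +-mono-≤ (f≤g zero) (∑-mono-≤ (f≤g ∘ suc))

∑-const : ∀ n c → ∑[ i < n ] c ≡ n * c
∑-const zero    c = refl
∑-const (suc n) c = cong (c +_) (∑-const n c)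

coloring : Color → Color → Color → Color → Color → Color → Coloring
coloring a b c d e f +x = a
coloring a b c d e f -x = b
coloring a b c d e f +y = c
coloring a b c d e f -y = d
coloring a b c d e f +z = e
coloring a b c d e f -z = f

-- one coloring per variety: color 0 on +x and the least color not on the x axis on +y
variety : Fin 30 → Coloring
variety = lookupᵛ
  ( coloring 0F 1F 2F 3F 4F 5F Vec.∷ coloring 0F 1F 2F 3F 5F 4F Vec.∷ coloring 0F 1F 2F 4F 3F 5F Vec.∷
    coloring 0F 1F 2F 4F 5F 3F Vec.∷ coloring 0F 1F 2F 5F 3F 4F Vec.∷ coloring 0F 1F 2F 5F 4F 3F Vec.∷
    coloring 0F 2F 1F 3F 4F 5F Vec.∷ coloring 0F 2F 1F 3F 5F 4F Vec.∷ coloring 0F 2F 1F 4F 3F 5F Vec.∷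
    coloring 0F 2F 1F 4F 5F 3F Vec.∷ coloring 0F 2F 1F 5F 3F 4F Vec.∷ coloring 0F 2F 1F 5F 4F 3F Vec.∷
    coloring 0F 3F 1F 2F 4F 5F Vec.∷ coloring 0F 3F 1F 2F 5F 4F Vec.∷ coloring 0F 3F 1F 4F 2F 5F Vec.∷
    coloring 0F 3F 1F 4F 5F 2F Vec.∷ coloring 0F 3F 1F 5F 2F 4F Vec.∷ coloring 0F 3F 1F 5F 4F 2F Vec.∷
    coloring 0F 4F 1F 2F 3F 5F Vec.∷ coloring 0F 4F 1F 2F 5F 3F Vec.∷ coloring 0F 4F 1F 3F 2F 5F Vec.∷
    coloring 0F 4F 1F 3F 5F 2F Vec.∷ coloring 0F 4F 1F 5F 2F 3F Vec.∷ coloring 0F 4F 1F 5F 3F 2F Vec.∷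
    coloring 0F 5F 1F 2F 3F 4F Vec.∷ coloring 0F 5F 1F 2F 4F 3F Vec.∷ coloring 0F 5F 1F 3F 2F 4F Vec.∷
    coloring 0F 5F 1F 3F 4F 2F Vec.∷ coloring 0F 5F 1F 4F 2F 3F Vec.∷ coloring 0F 5F 1F 4F 3F 2F Vec.∷ Vec.[])

injective? : (c : Coloring) → Dec (Injective _≡_ _≡_ c)
injective? c = map′ (λ h {f} {g} → h f g) (λ h f g → h)
  (∀-face? λ f → ∀-face? λ g → (c f ≟ᶜ c g) →-dec (f ≟ g))

variety-injective : ∀ k → Injective _≡_ _≡_ (variety k)
variety-injective = from-yes (all? (injective? ∘ variety))

fitCount : Coloring → ℕ
fitCount c = ∣ tabulate (λ k → does (fits? c (variety k))) ∣

fitCount-cong : ∀ {c d} → c ≗ d → fitCount c ≡ fitCount d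
fitCount-cong {c} {d} c≗d = cong ∣_∣ (tabulate-cong λ k → let v = variety k in
  does-⇔ (mk⇔ (fits-resp-≗ {c} {d} {v} c≗d) (fits-resp-≗ {d} {c} {v} (sym ∘ c≗d))) (fits? c v) (fits? d v))

fitCount≤21 : ∀ (x : Cube) → fitCount (col x) ≤ 21
fitCount≤21 (cube c c-inj) = subst (_≤ 21) (fitCount-cong (cong c ∘ face∘index))
  (bound-for-injections (c ∘ face) (face-injective ∘ c-inj))
  where
  bound-for-injections : ∀ h → Injective _≡_ _≡_ h → fitCount (h ∘ index) ≤ 21
  bound-for-injections = from-yes (all-injections? (λ h → fitCount (h ∘ index) ≤ 21)
    (λ h≗g → subst (_≤ 21) (fitCount-cong (h≗g ∘ index)))
    (λ h → fitCount (h ∘ index) ≤? 21))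

fitting : (I : Instance) → Coloring → Subset (length I)
fitting I v = tabulate λ i → does (fits? (col (lookup I i)) v)

corner : Fin 8 → Pos
corner 0F = true  , true  , true
corner 1F = true  , true  , false
corner 2F = true  , false , true
corner 3F = true  , false , false
corner 4F = false , true  , true
corner 5F = false , true  , false
corner 6F = false , false , true
corner 7F = false , false , false

corner-injective : Injective _≡_ _≡_ corner
corner-injective {i} {j} = from-yes (all? λ i → all? λ j → (corner i ≟ᵖ corner j) →-dec (i ≟ᶜ j)) i j
  where
  _≟ᵖ_ : (p q : Pos) → Dec (p ≡ q)
  _≟ᵖ_ = ≡-dec _≟ᵇ_ (≡-dec _≟ᵇ_ _≟ᵇ_)

universal⇒8≤∣fitting∣ : ∀ I → Universal I → ∀ x → 8 ≤ ∣ fitting I (col x) ∣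
universal⇒8≤∣fitting∣ I U x with U x
... | s , (sel , sel-inj , rot , placed , _) , (ρ , s≈x) =
  injection⇒≤∣p∣ (sel ∘ corner) (corner-injective ∘ sel-inj) λ k →
    let c = col (lookup I (sel (corner k)))
    in ∈-tabulate (dec-true (fits? c (col x)) (placed-fits {c} (rot (corner k)) ρ (placed (corner k)) s≈x))

lemma2 : (I : Instance) → Universal I → 12 ≤ size I
lemma2 I U = *-cancelʳ-< 21 11 n (<-≤-trans (from-yes (11 * 21 <? 30 * 8)) (begin
  30 * 8                                  ≡⟨ ∑-const 30 8 ⟨
  ∑[ k < 30 ] 8                           ≤⟨ ∑-mono-≤ (λ k → universal⇒8≤∣fitting∣ I U (varietyCube k)) ⟩
  ∑[ k < 30 ] ∣ fitting I (variety k) ∣   ≡⟨ double-counting (λ i k → does (fits? (col (lookup I i)) (variety k))) ⟨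
  ∑[ i < n ] fitCount (col (lookup I i))  ≤⟨ ∑-mono-≤ (λ i → fitCount≤21 (lookup I i)) ⟩
  ∑[ i < n ] 21                           ≡⟨ ∑-const n 21 ⟩
  n * 21                                  ∎))
  where
  open ≤-Reasoning
  n : ℕ
  n = length I
  varietyCube : Fin 30 → Cube
  varietyCube k = cube (variety k) (variety-injective k)
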